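{- For every $k\ge 2$, there exists a connected cograph $G$ such that $h(G)\ge k$ and $mh(G)\ge \frac{3}{2}h(G)-1$.
   Context: Cographs are defined recursively: a single vertex is a cograph; if $A$ and $B$ are cographs, their disjoint union and their join (disjoint union plus all edges between them) are cographs. Hunters and Rabbit game on a graph $G=(V,E)$. A hunter strategy is a finite sequence $(S_1,\dots,S_\ell)$ of non-empty subsets of $V$, using $\max_i|S_i|$ hunters. A rabbit trajectory is a walk $(r_0,\dots,r_\ell)$ in $G$ ($r_i\in N(r_{i-1})$); the strategy is winning if every rabbit trajectory has some $j<\ell$ with $r_j\in S_{j+1}$. $h(G)$ is the minimum number of hunters of a winning hunter strategy. Contaminated sets: $Z_0=V$, $Z_i=\{x : \exists y\in Z_{i-1}\setminus S_i,\ xy\in E\}$. A vertex $v$ is cleared at round $i$ if $v\in S_i$, or $N(v)\cap Z_{i-1}\ne\emptyset$ and $N(v)\cap Z_{i-1}\subseteq S_i$. A strategy is monotone if any vertex $v$ cleared at some round $i$ satisfies $v\in S_{j+1}$ whenever $j>i$ and $v\in Z_j$. $mh(G)$ is the minimum number of hunters of a monotone winning hunter strategy. -}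

module Defs where

open import Data.Nat using (ℕ; zero; suc; _+_; _*_; _≤_; _<_)
open import Data.Fin using (Fin; splitAt)
open import Data.Fin.Subset using (Subset; _∈_; _∉_; ∣_∣; Nonempty)
open import Data.Sum using (_⊎_; inj₁; inj₂)
open import Data.Product using (Σ; ∃; ∃-syntax; _×_; _,_)
open import Data.Unit using (⊤)
open import Data.Empty using (⊥)
open import Relation.Binary.Construct.Closure.ReflexiveTransitive using (Star)

Graph : ℕ → Set₁
Graph n = Fin n → Fin n → Set

-- Cographs, via cotrees: leaf = single vertex, union / join of two cographs.
-- Vertices of a union/join on Fin (m + n): the first m belong to the left
-- part, the last n to the right part (Data.Fin.splitAt).

data Cotree : ℕ → Set where
  leaf  : Cotree 1
  union : ∀ {m n} → Cotree m → Cotree n → Cotree (m + n)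
  join  : ∀ {m n} → Cotree m → Cotree n → Cotree (m + n)

mutual
  Adj : ∀ {n} → Cotree n → Graph n
  Adj leaf x y = ⊥
  Adj (union {m} A B) x y = combine A B ⊥ (splitAt m x) (splitAt m y)
  Adj (join {m} A B) x y = combine A B ⊤ (splitAt m x) (splitAt m y)

  combine : ∀ {m n} → Cotree m → Cotree n → Set →
            Fin m ⊎ Fin n → Fin m ⊎ Fin n → Set
  combine A B cross (inj₁ a) (inj₁ b) = Adj A a b
  combine A B cross (inj₂ a) (inj₂ b) = Adj B a b
  combine A B cross (inj₁ _) (inj₂ _) = cross
  combine A B cross (inj₂ _) (inj₁ _) = cross

Connected : ∀ {n} → Graph n → Set
Connected {n} E = (x y : Fin n) → Star E x y

-- Hunters and Rabbit.
-- A hunter strategy (S_1,…,S_ℓ) is a length ℓ together with S : ℕ → Subset n;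
-- only S 1, …, S ℓ are meaningful (S i is the set S_i).

record Strategy (n : ℕ) : Set where
  constructor strat
  field
    len : ℕ
    S   : ℕ → Subset n
open Strategy public

NonEmptySets : ∀ {n} → Strategy n → Set
NonEmptySets σ = ∀ i → 1 ≤ i → i ≤ len σ → Nonempty (S σ i)

UsesAtMost : ∀ {n} → Strategy n → ℕ → Set
UsesAtMost σ p = ∀ i → 1 ≤ i → i ≤ len σ → ∣ S σ i ∣ ≤ p

-- r is a rabbit trajectory (r_0,…,r_ℓ): r_{i+1} ∈ N(r_i) for i < ℓ
-- (values of r beyond ℓ are irrelevant)
Trajectory : ∀ {n} → Graph n → ℕ → (ℕ → Fin n) → Set
Trajectory E ℓ r = ∀ i → i < ℓ → E (r i) (r (suc i))

Winning : ∀ {n} → Graph n → Strategy n → Set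
Winning E σ = ∀ (r : ℕ → _) → Trajectory E (len σ) r →
  ∃[ j ] (j < len σ × r j ∈ S σ (suc j))

Z : ∀ {n} → Graph n → Strategy n → ℕ → Fin n → Set
Z E σ zero x = ⊤
Z E σ (suc i) x = ∃[ y ] (Z E σ i y × y ∉ S σ (suc i) × E x y)

ClearedAt : ∀ {n} → Graph n → Strategy n → ℕ → Fin n → Set
ClearedAt E σ zero v = ⊥
ClearedAt E σ (suc i) v =
  v ∈ S σ (suc i) ⊎
  ((∃[ u ] (E v u × Z E σ i u)) ×
   (∀ u → E v u → Z E σ i u → u ∈ S σ (suc i)))

Monotone : ∀ {n} → Graph n → Strategy n → Set
Monotone E σ = ∀ v i j → 1 ≤ i → i ≤ len σ → ClearedAt E σ i v →
  i < j → suc j ≤ len σ → Z E σ j v → v ∈ S σ (suc j)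

WinsWith : ∀ {n} → Graph n → ℕ → Set
WinsWith {n} E p = Σ (Strategy n) λ σ → NonEmptySets σ × UsesAtMost σ p × Winning E σ

MonotoneWinsWith : ∀ {n} → Graph n → ℕ → Set
MonotoneWinsWith {n} E p =
  Σ (Strategy n) λ σ → NonEmptySets σ × UsesAtMost σ p × Winning E σ × Monotone E σ

IsHunterNumber : ∀ {n} → Graph n → ℕ → Set
IsHunterNumber E h = WinsWith E h × (∀ p → WinsWith E p → h ≤ p)

IsMonotoneHunterNumber : ∀ {n} → Graph n → ℕ → Set
IsMonotoneHunterNumber E m = MonotoneWinsWith E m × (∀ p → MonotoneWinsWith E p → m ≤ p)

-- The cograph is an independent set A joined to the disjoint union of an
-- independent set C and a clique K, each of size t = k.  Shooting A, K, K, A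
-- catches the rabbit, while with fewer than t hunters some vertex of A and some
-- vertex of C escape every round, so the complete bipartite graph between A
-- and C never gets clean: h = t.  Shooting A and all of K but one vertex twice
-- is a monotone win with 2t - 1 hunters.  Against a monotone strategy with
-- fewer, K stays contaminated forever: whenever A or C is shot entirely, two
-- vertices of K are not.  C only gets cleared by shooting all of A, and once a
-- vertex of A is released again C is recontaminated, so monotonicity forces all
-- of C to be shot in the next round.  Hence mh = 2t - 1 >= 3t/2 - 1.
module Submission where

open import Defs
open import Data.Empty using (⊥; ⊥-elim)
open import Data.Fin using (Fin; zero; suc; splitAt; _↑ˡ_; _↑ʳ_; punchIn)
open import Data.Fin.Properties
  using (0≢1+n; suc-injective; ↑ˡ-injective; ↑ʳ-injective; splitAt-↑ˡ; splitAt-↑ʳ;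
         splitAt⁻¹-↑ˡ; splitAt⁻¹-↑ʳ; punchIn-injective; punchInᵢ≢i; all?; ¬∀⟶∃¬)
  renaming (_≟_ to _≟ᶠ_)
open import Data.Fin.Subset using (Subset; _∈_; _∉_; ∣_∣; _-_; inside; outside)
import Data.Fin.Subset as Subset
open import Data.Fin.Subset.Properties
  using (_∈?_; ∈⊤; ∣⊤∣≡n; ∣⊥∣≡0; x∈p∧x≢y⇒x∈p-y; x∈p⇒∣p-x∣<∣p∣)
open import Data.Nat using (ℕ; zero; suc; _+_; _*_; _≤_; _<_; z≤n; s≤s; z<s; s<s; _≤?_; _≟_)
open import Data.Nat.Properties
  using (≤-refl; ≤-reflexive; ≤-pred; ≤-trans; ≤-<-trans; <-≤-trans; <⇒≤; ≤∧≢⇒<; <⇒≱; ≮⇒≥;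
         n≤1+n; m≤m+n; m<n⇒m<1+n; +-monoʳ-≤; +-identityʳ)
open import Data.Nat.Tactic.RingSolver using (solve-∀)
open import Data.Product using (Σ; ∃; ∃₂; ∃-syntax; _×_; _,_; proj₁; proj₂)
open import Data.Sum using (_⊎_; inj₁; inj₂)
open import Data.Unit using (tt)
open import Data.Vec using (_∷_; []; _++_; here; there)
import Data.Vec.Functional as Vector
open import Function using (const; _∘_)
open import Function.Definitions using (Injective)
open import Relation.Binary.Definitions using (Symmetric)
open import Relation.Binary.Construct.Closure.ReflexiveTransitive using (Star; ε; _◅_; _◅◅_; reverse)
open import Relation.Binary.PropositionalEquality using (_≡_; _≢_; refl; sym; trans; cong; cong₂; subst; module ≡-Reasoning)
open import Relation.Nullary using (¬_; yes; no; contradiction)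

mutual
  Adj-sym : ∀ {n} (T : Cotree n) → Symmetric (Adj T)
  Adj-sym leaf ()
  Adj-sym (union {m} A B) {x} {y} = combine-sym A B (splitAt m x) (splitAt m y)
  Adj-sym (join {m} A B) {x} {y} = combine-sym A B (splitAt m x) (splitAt m y)

  combine-sym : ∀ {m n X} (A : Cotree m) (B : Cotree n) u v →
                combine A B X u v → combine A B X v u
  combine-sym A B (inj₁ a) (inj₁ b) e = Adj-sym A e
  combine-sym A B (inj₂ a) (inj₂ b) e = Adj-sym B e
  combine-sym A B (inj₁ _) (inj₂ _) e = e
  combine-sym A B (inj₂ _) (inj₁ _) e = e

edgeless : ∀ n → Cotree (suc n)
edgeless zero = leaf
edgeless (suc n) = union leaf (edgeless n)

complete : ∀ n → Cotree (suc n)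
complete zero = leaf
complete (suc n) = join leaf (complete n)

edgeless-¬Adj : ∀ n x y → ¬ Adj (edgeless n) x y
edgeless-¬Adj zero x y ()
edgeless-¬Adj (suc n) zero zero ()
edgeless-¬Adj (suc n) zero (suc y) ()
edgeless-¬Adj (suc n) (suc x) zero ()
edgeless-¬Adj (suc n) (suc x) (suc y) e = edgeless-¬Adj n x y e

complete-Adj : ∀ n x y → x ≢ y → Adj (complete n) x y
complete-Adj zero zero zero x≢y = x≢y refl
complete-Adj (suc n) zero zero x≢y = x≢y refl
complete-Adj (suc n) zero (suc y) _ = tt
complete-Adj (suc n) (suc x) zero _ = tt
complete-Adj (suc n) (suc x) (suc y) x≢y = complete-Adj n x y (x≢y ∘ cong suc)

complete-irrefl : ∀ n x → ¬ Adj (complete n) x x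
complete-irrefl zero zero ()
complete-irrefl (suc n) zero ()
complete-irrefl (suc n) (suc x) e = complete-irrefl n x e

Escapes : ∀ {n} → Graph n → Strategy n → ℕ → (ℕ → Fin n) → Set
Escapes E σ j r = ∀ i → i < j → E (r i) (r (suc i)) × r i ∉ S σ (suc i)

extend : ∀ {A : Set} → (ℕ → A) → ℕ → A → ℕ → A
extend r j x i with i ≤? j
... | yes _ = r i
... | no _ = x

extend-≤ : ∀ {A : Set} (r : ℕ → A) j x i → i ≤ j → extend r j x i ≡ r i
extend-≤ r j x i i≤j with i ≤? j
... | yes _ = refl
... | no i≰j = contradiction i≤j i≰j

extend-> : ∀ {A : Set} (r : ℕ → A) j x i → j < i → extend r j x i ≡ x
extend-> r j x i j<i with i ≤? j
... | yes i≤j = contradiction i≤j (<⇒≱ j<i)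
... | no _ = refl

module _ {n} {E : Graph n} (E-sym : Symmetric E) (σ : Strategy n) where

  contaminated⇒escape : ∀ j x → Z E σ j x → ∃ λ r → r j ≡ x × Escapes E σ j r
  contaminated⇒escape zero x _ = const x , refl , λ _ ()
  contaminated⇒escape (suc j) x (y , y∈Z , y∉S , x~y) with contaminated⇒escape j y y∈Z
  ... | r , r[j]≡y , escapes = extend r j x , extend-> r j x (suc j) ≤-refl , escapes′
    where
    escapes′ : Escapes E σ (suc j) (extend r j x)
    escapes′ i (s≤s i≤j) with i ≟ j
    ... | yes refl rewrite extend-≤ r i x i ≤-refl | extend-> r i x (suc i) ≤-refl | r[j]≡y =
      E-sym x~y , y∉S
    ... | no i≢j rewrite extend-≤ r j x i i≤j | extend-≤ r j x (suc i) (≤∧≢⇒< i≤j i≢j) =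
      escapes i (≤∧≢⇒< i≤j i≢j)

  contaminated⇒¬winning : ∀ {x} → Z E σ (len σ) x → ¬ Winning E σ
  contaminated⇒¬winning z wins with contaminated⇒escape (len σ) _ z
  ... | r , _ , escapes with wins r (λ i i<ℓ → proj₁ (escapes i i<ℓ))
  ... | j , j<ℓ , caught = proj₂ (escapes j j<ℓ) caught

injective⇒≤∣p∣ : ∀ {m n} {f : Fin m → Fin n} → Injective _≡_ _≡_ f →
                 (p : Subset n) → (∀ i → f i ∈ p) → m ≤ ∣ p ∣
injective⇒≤∣p∣ {zero} _ _ _ = z≤n
injective⇒≤∣p∣ {suc m} {f = f} f-inj p f∈p =
  ≤-<-trans (injective⇒≤∣p∣ (suc-injective ∘ f-inj) (p - f zero) f∘suc∈p-f₀)
            (x∈p⇒∣p-x∣<∣p∣ (f∈p zero))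
  where
  f∘suc∈p-f₀ : ∀ i → f (suc i) ∈ p - f zero
  f∘suc∈p-f₀ i = x∈p∧x≢y⇒x∈p-y (f∈p (suc i)) (0≢1+n ∘ sym ∘ f-inj)

injective⇒∃∉ : ∀ {m n} {f : Fin m → Fin n} → Injective _≡_ _≡_ f →
               (p : Subset n) → ∣ p ∣ < m → ∃ λ i → f i ∉ p
injective⇒∃∉ {m} {f = f} f-inj p ∣p∣<m =
  ¬∀⟶∃¬ m _ (λ i → f i ∈? p) (<⇒≱ ∣p∣<m ∘ injective⇒≤∣p∣ f-inj p)

module _ {a b n} {f : Fin a → Fin n} {g : Fin b → Fin n} where

  ++-injective : Injective _≡_ _≡_ f → Injective _≡_ _≡_ g → (∀ i j → f i ≢ g j) →
                 Injective _≡_ _≡_ (f Vector.++ g)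
  ++-injective f-inj g-inj f≢g {i} {j} eq with splitAt a i in split-i | splitAt a j in split-j
  ... | inj₁ x | inj₁ y =
    trans (sym (splitAt⁻¹-↑ˡ split-i)) (trans (cong (_↑ˡ b) (f-inj eq)) (splitAt⁻¹-↑ˡ split-j))
  ... | inj₂ x | inj₂ y =
    trans (sym (splitAt⁻¹-↑ʳ split-i)) (trans (cong (a ↑ʳ_) (g-inj eq)) (splitAt⁻¹-↑ʳ split-j))
  ... | inj₁ x | inj₂ y = contradiction eq (f≢g x y)
  ... | inj₂ x | inj₁ y = contradiction (sym eq) (f≢g y x)

  ++-∃∉ : Injective _≡_ _≡_ (f Vector.++ g) → (p : Subset n) → ∣ p ∣ < a + b →
          (∃ λ i → f i ∉ p) ⊎ (∃ λ j → g j ∉ p)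
  ++-∃∉ inj p ∣p∣<a+b with injective⇒∃∉ inj p ∣p∣<a+b
  ... | i , i∉p with splitAt a i
  ...   | inj₁ x = inj₁ (x , i∉p)
  ...   | inj₂ y = inj₂ (y , i∉p)

  ++-∃∉ʳ : Injective _≡_ _≡_ (f Vector.++ g) → (p : Subset n) → (∀ i → f i ∈ p) →
           ∣ p ∣ < a + b → ∃ λ j → g j ∉ p
  ++-∃∉ʳ inj p f∈p ∣p∣<a+b with ++-∃∉ inj p ∣p∣<a+b
  ... | inj₁ (i , fi∉p) = contradiction (f∈p i) fi∉p
  ... | inj₂ g∉p = g∉p

∈-++⁺ˡ : ∀ {m n} {p : Subset m} {x} (q : Subset n) → x ∈ p → x ↑ˡ n ∈ p ++ q
∈-++⁺ˡ q here = here
∈-++⁺ˡ q (there x∈p) = there (∈-++⁺ˡ q x∈p)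

∈-++⁺ʳ : ∀ {m n} (p : Subset m) {q : Subset n} {x} → x ∈ q → m ↑ʳ x ∈ p ++ q
∈-++⁺ʳ [] x∈q = x∈q
∈-++⁺ʳ (_ ∷ p) x∈q = there (∈-++⁺ʳ p x∈q)

∣p++q∣≡∣p∣+∣q∣ : ∀ {m n} (p : Subset m) (q : Subset n) → ∣ p ++ q ∣ ≡ ∣ p ∣ + ∣ q ∣
∣p++q∣≡∣p∣+∣q∣ [] q = refl
∣p++q∣≡∣p∣+∣q∣ (outside ∷ p) q = ∣p++q∣≡∣p∣+∣q∣ p q
∣p++q∣≡∣p∣+∣q∣ (inside ∷ p) q = cong suc (∣p++q∣≡∣p∣+∣q∣ p q)

short⇒monotone : ∀ {n} {E : Graph n} (σ : Strategy n) → len σ ≤ 2 → Monotone E σ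
short⇒monotone σ ℓ≤2 _ _ _ 1≤i _ _ i<j j<ℓ _ =
  contradiction (≤-pred (≤-trans j<ℓ ℓ≤2)) (<⇒≱ (≤-<-trans 1≤i i<j))

VertexCover : ∀ {n} → Graph n → Subset n → Set
VertexCover E p = ∀ {x y} → E x y → x ∈ p ⊎ y ∈ p

vertexCover⇒twice-winning : ∀ {n} {E : Graph n} {p} → VertexCover E p → Winning E (strat 2 (const p))
vertexCover⇒twice-winning {p = p} cover r walk with r 0 ∈? p | cover (walk 0 z<s)
... | yes r₀∈p | _ = 0 , z<s , r₀∈p
... | no r₀∉p | inj₁ r₀∈p = contradiction r₀∈p r₀∉p
... | no _ | inj₂ r₁∈p = 1 , s<s z<s , r₁∈p

module Witness (u : ℕ) where

  t : ℕ
  t = suc u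

  N : ℕ
  N = t + (t + t)

  G : Cotree N
  G = join (edgeless u) (union (edgeless u) (complete u))

  E : Graph N
  E = Adj G

  E-sym : Symmetric E
  E-sym {x} {y} = Adj-sym G {x} {y}

  A C K : Fin t → Fin N
  A i = i ↑ˡ (t + t)
  C i = t ↑ʳ (i ↑ˡ t)
  K i = t ↑ʳ (t ↑ʳ i)

  A~C : ∀ i j → E (A i) (C j)
  A~C i j rewrite splitAt-↑ˡ t i (t + t) | splitAt-↑ʳ t (t + t) (j ↑ˡ t) = tt

  A~K : ∀ i j → E (A i) (K j)
  A~K i j rewrite splitAt-↑ˡ t i (t + t) | splitAt-↑ʳ t (t + t) (t ↑ʳ j) = tt

  C~A : ∀ i j → E (C i) (A j)
  C~A i j = E-sym {A j} {C i} (A~C j i)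

  K~A : ∀ i j → E (K i) (A j)
  K~A i j = E-sym {A j} {K i} (A~K j i)

  K~K : ∀ i j → i ≢ j → E (K i) (K j)
  K~K i j i≢j rewrite splitAt-↑ʳ t (t + t) (t ↑ʳ i) | splitAt-↑ʳ t (t + t) (t ↑ʳ j)
                    | splitAt-↑ʳ t t i | splitAt-↑ʳ t t j = complete-Adj u i j i≢j

  A≁A : ∀ i j → ¬ E (A i) (A j)
  A≁A i j rewrite splitAt-↑ˡ t i (t + t) | splitAt-↑ˡ t j (t + t) = edgeless-¬Adj u i j

  C≁C : ∀ i j → ¬ E (C i) (C j)
  C≁C i j rewrite splitAt-↑ʳ t (t + t) (i ↑ˡ t) | splitAt-↑ʳ t (t + t) (j ↑ˡ t)
                | splitAt-↑ˡ t i t | splitAt-↑ˡ t j t = edgeless-¬Adj u i j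

  C≁K : ∀ i j → ¬ E (C i) (K j)
  C≁K i j rewrite splitAt-↑ʳ t (t + t) (i ↑ˡ t) | splitAt-↑ʳ t (t + t) (t ↑ʳ j)
                | splitAt-↑ˡ t i t | splitAt-↑ʳ t t j = λ ()

  K≁K : ∀ i → ¬ E (K i) (K i)
  K≁K i rewrite splitAt-↑ʳ t (t + t) (t ↑ʳ i) | splitAt-↑ʳ t t i = complete-irrefl u i

  data View : Fin N → Set where
    vA : ∀ i → View (A i)
    vC : ∀ i → View (C i)
    vK : ∀ i → View (K i)

  view : ∀ x → View x
  view x with splitAt t x in split-x
  ... | inj₁ i = subst View (splitAt⁻¹-↑ˡ split-x) (vA i)
  ... | inj₂ y with splitAt t y in split-y
  ...   | inj₁ i = subst View (trans (cong (t ↑ʳ_) (splitAt⁻¹-↑ˡ split-y)) (splitAt⁻¹-↑ʳ split-x)) (vC i)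
  ...   | inj₂ i = subst View (trans (cong (t ↑ʳ_) (splitAt⁻¹-↑ʳ split-y)) (splitAt⁻¹-↑ʳ split-x)) (vK i)

  C-neighbours-⊆ : ∀ {p} → (∀ a → A a ∈ p) → ∀ i {v} → E (C i) v → v ∈ p
  C-neighbours-⊆ A⊆p i {v} e with view v
  ... | vA a = A⊆p a
  ... | vC c = contradiction e (C≁C i c)
  ... | vK k = contradiction e (C≁K i k)

  A-injective : Injective _≡_ _≡_ A
  A-injective = ↑ˡ-injective (t + t) _ _

  C-injective : Injective _≡_ _≡_ C
  C-injective = ↑ˡ-injective t _ _ ∘ ↑ʳ-injective t _ _

  K-injective : Injective _≡_ _≡_ K
  K-injective = ↑ʳ-injective t _ _ ∘ ↑ʳ-injective t _ _

  K∘punchIn-injective : ∀ k → Injective _≡_ _≡_ (K ∘ punchIn k)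
  K∘punchIn-injective k = punchIn-injective k _ _ ∘ K-injective

  A≢K : ∀ i j → A i ≢ K j
  A≢K i j eq
    with trans (sym (splitAt-↑ˡ t i (t + t))) (trans (cong (splitAt t) eq) (splitAt-↑ʳ t (t + t) (t ↑ʳ j)))
  ... | ()

  C≢K : ∀ i j → C i ≢ K j
  C≢K i j eq
    with trans (sym (splitAt-↑ˡ t i t)) (trans (cong (splitAt t) (↑ʳ-injective t _ _ eq)) (splitAt-↑ʳ t t j))
  ... | ()

  connected : Connected E
  connected x y = to-A₀ x ◅◅ reverse (λ {x} {y} → E-sym {x} {y}) (to-A₀ y)
    where
    to-A₀ : ∀ x → Star E x (A zero)
    to-A₀ x with view x
    ... | vA i = A~C i zero ◅ C~A zero zero ◅ ε
    ... | vC i = C~A i zero ◅ ε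
    ... | vK i = K~A i zero ◅ ε

  -- SM misses exactly C and K zero, an independent set
  SA SK SM : Subset N
  SA = Subset.⊤ {t} ++ Subset.⊥ {t + t}
  SK = Subset.⊥ {t} ++ (Subset.⊥ {t} ++ Subset.⊤ {t})
  SM = Subset.⊤ {t} ++ (Subset.⊥ {t} ++ (outside ∷ Subset.⊤ {u}))

  A∈SA : ∀ i → A i ∈ SA
  A∈SA i = ∈-++⁺ˡ Subset.⊥ ∈⊤

  K∈SK : ∀ i → K i ∈ SK
  K∈SK i = ∈-++⁺ʳ (Subset.⊥ {t}) (∈-++⁺ʳ (Subset.⊥ {t}) ∈⊤)

  A∈SM : ∀ i → A i ∈ SM
  A∈SM i = ∈-++⁺ˡ (Subset.⊥ {t} ++ (outside ∷ Subset.⊤ {u})) ∈⊤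

  K₊∈SM : ∀ i → K (suc i) ∈ SM
  K₊∈SM i = ∈-++⁺ʳ (Subset.⊤ {t}) (∈-++⁺ʳ (Subset.⊥ {t}) (there ∈⊤))

  ∣SA∣≡t : ∣ SA ∣ ≡ t
  ∣SA∣≡t = begin
    ∣ SA ∣                                   ≡⟨ ∣p++q∣≡∣p∣+∣q∣ (Subset.⊤ {t}) _ ⟩
    ∣ Subset.⊤ {t} ∣ + ∣ Subset.⊥ {t + t} ∣  ≡⟨ cong₂ _+_ (∣⊤∣≡n t) (∣⊥∣≡0 (t + t)) ⟩
    t + 0                                    ≡⟨ +-identityʳ t ⟩
    t                                        ∎
    where open ≡-Reasoning

  ∣SK∣≡t : ∣ SK ∣ ≡ t
  ∣SK∣≡t = begin
    ∣ SK ∣                                  ≡⟨ ∣p++q∣≡∣p∣+∣q∣ (Subset.⊥ {t}) _ ⟩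
    ∣ Subset.⊥ {t} ∣ + ∣ Subset.⊥ {t} ++ Subset.⊤ ∣
                                            ≡⟨ cong₂ _+_ (∣⊥∣≡0 t) (∣p++q∣≡∣p∣+∣q∣ (Subset.⊥ {t}) _) ⟩
    ∣ Subset.⊥ {t} ∣ + ∣ Subset.⊤ {t} ∣     ≡⟨ cong₂ _+_ (∣⊥∣≡0 t) (∣⊤∣≡n t) ⟩
    t                                       ∎
    where open ≡-Reasoning

  ∣SM∣≡t+u : ∣ SM ∣ ≡ t + u
  ∣SM∣≡t+u = begin
    ∣ SM ∣                                  ≡⟨ ∣p++q∣≡∣p∣+∣q∣ (Subset.⊤ {t}) _ ⟩
    ∣ Subset.⊤ {t} ∣ + ∣ Subset.⊥ {t} ++ (outside ∷ Subset.⊤) ∣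
                                            ≡⟨ cong₂ _+_ (∣⊤∣≡n t) (∣p++q∣≡∣p∣+∣q∣ (Subset.⊥ {t}) _) ⟩
    t + (∣ Subset.⊥ {t} ∣ + ∣ Subset.⊤ {u} ∣) ≡⟨ cong (t +_) (cong₂ _+_ (∣⊥∣≡0 t) (∣⊤∣≡n u)) ⟩
    t + u                                   ∎
    where open ≡-Reasoning

  -- rounds 1 to 4 shoot A, K, K, A; the other values are never used
  hunt : ℕ → Subset N
  hunt 2 = SK
  hunt 3 = SK
  hunt _ = SA

  hunt-cases : ∀ i → hunt i ≡ SA ⊎ hunt i ≡ SK
  hunt-cases 0 = inj₁ refl
  hunt-cases 1 = inj₁ refl
  hunt-cases 2 = inj₂ refl
  hunt-cases 3 = inj₂ refl
  hunt-cases (suc (suc (suc (suc _)))) = inj₁ refl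

  no-walk-avoids-hunt : ∀ x₀ x₁ x₂ x₃ → E x₀ x₁ → E x₁ x₂ → E x₂ x₃ →
                        x₀ ∉ SA → x₁ ∉ SK → x₂ ∉ SK → x₃ ∉ SA → ⊥
  no-walk-avoids-hunt x₀ x₁ x₂ x₃ e₀₁ e₁₂ e₂₃ x₀∉ x₁∉ x₂∉ x₃∉ with view x₁
  ... | vK k = x₁∉ (K∈SK k)
  ... | vC c = x₀∉ (C-neighbours-⊆ A∈SA c (E-sym {x₀} {C c} e₀₁))
  ... | vA a with view x₂
  ...   | vA a′ = A≁A a a′ e₁₂
  ...   | vK k = x₂∉ (K∈SK k)
  ...   | vC c = x₃∉ (C-neighbours-⊆ A∈SA c e₂₃)

  huntStrategy : Strategy N
  huntStrategy = strat 4 hunt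

  huntStrategy-wins : WinsWith E t
  huntStrategy-wins = huntStrategy , nonempty , small , wins
    where
    nonempty : NonEmptySets huntStrategy
    nonempty i _ _ with hunt-cases i
    ... | inj₁ eq = A zero , subst (A zero ∈_) (sym eq) (A∈SA zero)
    ... | inj₂ eq = K zero , subst (K zero ∈_) (sym eq) (K∈SK zero)

    small : UsesAtMost huntStrategy t
    small i _ _ with hunt-cases i
    ... | inj₁ eq = ≤-reflexive (trans (cong ∣_∣ eq) ∣SA∣≡t)
    ... | inj₂ eq = ≤-reflexive (trans (cong ∣_∣ eq) ∣SK∣≡t)

    wins : Winning E huntStrategy
    wins r walk with r 0 ∈? SA | r 1 ∈? SK | r 2 ∈? SK | r 3 ∈? SA
    ... | yes caught | _ | _ | _ = 0 , z<s , caught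
    ... | no _ | yes caught | _ | _ = 1 , s<s z<s , caught
    ... | no _ | no _ | yes caught | _ = 2 , s<s (s<s z<s) , caught
    ... | no _ | no _ | no _ | yes caught = 3 , s<s (s<s (s<s z<s)) , caught
    ... | no r₀∉ | no r₁∉ | no r₂∉ | no r₃∉ =
      ⊥-elim (no-walk-avoids-hunt (r 0) (r 1) (r 2) (r 3)
                (walk 0 z<s) (walk 1 (s<s z<s)) (walk 2 (s<s (s<s z<s))) r₀∉ r₁∉ r₂∉ r₃∉)

  SM-vertexCover : VertexCover E SM
  SM-vertexCover {x} {y} e with view x
  ... | vA a = inj₁ (A∈SM a)
  ... | vK (suc k) = inj₁ (K₊∈SM k)
  ... | vC c = inj₂ (C-neighbours-⊆ A∈SM c e)
  ... | vK zero with view y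
  ...   | vA a = inj₂ (A∈SM a)
  ...   | vK (suc k) = inj₂ (K₊∈SM k)
  ...   | vC c = contradiction (E-sym {K zero} {C c} e) (C≁K c zero)
  ...   | vK zero = contradiction e (K≁K zero)

  coverStrategy-wins : MonotoneWinsWith E (t + u)
  coverStrategy-wins =
    σ , (λ _ _ _ → A zero , A∈SM zero) , (λ _ _ _ → ≤-reflexive ∣SM∣≡t+u) ,
    vertexCover⇒twice-winning SM-vertexCover , short⇒monotone σ ≤-refl
    where
    σ : Strategy N
    σ = strat 2 (const SM)

  fewer-than-t-lose : ∀ {p} → p < t → ¬ WinsWith E p
  fewer-than-t-lose p<t (σ , _ , σ≤p , wins) =
    contaminated⇒¬winning (λ {x} {y} → E-sym {x} {y}) σ
      (proj₁ (A∪C-contaminated (len σ) ≤-refl) zero) wins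
    where
    A∪C-contaminated : ∀ j → j ≤ len σ → (∀ i → Z E σ j (A i)) × (∀ i → Z E σ j (C i))
    A∪C-contaminated zero _ = const tt , const tt
    A∪C-contaminated (suc j) j<ℓ
      with A∪C-contaminated j (<⇒≤ j<ℓ)
         | injective⇒∃∉ A-injective (S σ (suc j)) (≤-<-trans (σ≤p (suc j) z<s j<ℓ) p<t)
         | injective⇒∃∉ C-injective (S σ (suc j)) (≤-<-trans (σ≤p (suc j) z<s j<ℓ) p<t)
    ... | zA , zC | a , a∉ | c , c∉ =
      (λ i → C c , zC c , c∉ , A~C i c) , (λ i → A a , zA a , a∉ , C~A i a)

  hunters-≥ : ∀ p → WinsWith E p → t ≤ p
  hunters-≥ p wins = ≮⇒≥ (λ p<t → fewer-than-t-lose p<t wins)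

  module MonotoneLowerBound (σ : Strategy N) {p} (p<t+u : p < t + u) (σ≤p : UsesAtMost σ p)
                            (monotone : Monotone E σ) where

    Shot : ℕ → Subset N
    Shot j = S σ (suc j)

    few-shot : ∀ {j} → suc j ≤ len σ → ∣ Shot j ∣ < t + u
    few-shot {j} j<ℓ = ≤-<-trans (σ≤p (suc j) z<s j<ℓ) p<t+u

    fewer-than-2t-shot : ∀ {j} → suc j ≤ len σ → ∣ Shot j ∣ < t + t
    fewer-than-2t-shot j<ℓ = <-≤-trans (few-shot j<ℓ) (+-monoʳ-≤ t (n≤1+n u))

    ClearedBefore : ℕ → Fin N → Set
    ClearedBefore j v = ∃[ r ] (r < j × ClearedAt E σ r v)

    ClearedBefore-suc : ∀ {j v} → ClearedBefore j v → ClearedBefore (suc j) v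
    ClearedBefore-suc (r , r<j , cleared) = r , m<n⇒m<1+n r<j , cleared

    recontaminated⇒shot : ∀ {j v} → suc j ≤ len σ → ClearedBefore j v → Z E σ j v → v ∈ Shot j
    recontaminated⇒shot j<ℓ (zero , _ , ())
    recontaminated⇒shot {j} j<ℓ (suc r , r<j , cleared) z =
      monotone _ (suc r) j z<s (<⇒≤ (<-≤-trans r<j (<⇒≤ j<ℓ))) cleared r<j j<ℓ z

    two-K-unshot : ∀ {j} → suc j ≤ len σ → (X : Fin t → Fin N) → Injective _≡_ _≡_ X →
                   (∀ i k → X i ≢ K k) → (∀ i → X i ∈ Shot j) →
                   ∃₂ λ k₁ k₂ → k₁ ≢ k₂ × K k₁ ∉ Shot j × K k₂ ∉ Shot j
    two-K-unshot {j} j<ℓ X X-inj X≢K X⊆shot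
      with ++-∃∉ʳ (++-injective X-inj K-injective X≢K) (Shot j) X⊆shot (fewer-than-2t-shot j<ℓ)
    ... | k₁ , k₁∉ with ++-∃∉ʳ (++-injective X-inj (K∘punchIn-injective k₁) (λ i k → X≢K i (punchIn k₁ k)))
                              (Shot j) X⊆shot (few-shot j<ℓ)
    ...   | k , k₂∉ = k₁ , punchIn k₁ k , punchInᵢ≢i k₁ k ∘ sym , k₁∉ , k₂∉

    A∪K-stay-contaminated : ∀ {j} → suc j ≤ len σ → (X : Fin t → Fin N) → Injective _≡_ _≡_ X →
                            (∀ i k → X i ≢ K k) → (∀ i → X i ∈ Shot j) → (∀ k → Z E σ j (K k)) →
                            (∀ i → Z E σ (suc j) (A i)) × (∀ k → Z E σ (suc j) (K k))
    A∪K-stay-contaminated {j} j<ℓ X X-inj X≢K X⊆shot zK with two-K-unshot j<ℓ X X-inj X≢K X⊆shot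
    ... | k₁ , k₂ , k₁≢k₂ , k₁∉ , k₂∉ = (λ i → K k₁ , zK k₁ , k₁∉ , A~K i k₁) , zK′
      where
      zK′ : ∀ k → Z E σ (suc j) (K k)
      zK′ k with k ≟ᶠ k₁
      ... | yes refl = K k₂ , zK k₂ , k₂∉ , K~K k k₂ k₁≢k₂
      ... | no k≢k₁ = K k₁ , zK k₁ , k₁∉ , K~K k k₁ k≢k₁

    unshot-A-contaminates : ∀ {j a} → Z E σ j (A a) → A a ∉ Shot j →
                            (∀ i → Z E σ (suc j) (C i)) × (∀ k → Z E σ (suc j) (K k))
    unshot-A-contaminates {a = a} zA a∉ =
      (λ i → A a , zA , a∉ , C~A i a) , (λ k → A a , zA , a∉ , K~A k a)

    A-shot? : ∀ j → (∀ i → A i ∈ Shot j) ⊎ ∃ (λ a → A a ∉ Shot j)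
    A-shot? j with all? (λ i → A i ∈? Shot j)
    ... | yes A⊆shot = inj₁ A⊆shot
    ... | no A⊈shot = inj₂ (¬∀⟶∃¬ t _ (λ i → A i ∈? Shot j) A⊈shot)

    -- C-recontaminated remembers that C was cleared earlier, so monotonicity forces it to be shot.
    data Phase (j : ℕ) : Set where
      untouched : (∀ x → Z E σ j x) → Phase j
      C-cleared : (∀ i → Z E σ j (A i)) → (∀ k → Z E σ j (K k)) →
                  (∀ i → ClearedBefore (suc j) (C i)) → Phase j
      C-recontaminated : (∀ i → Z E σ j (C i)) → (∀ k → Z E σ j (K k)) →
                         (∀ i → ClearedBefore j (C i)) → Phase j

    Phase⇒K-contaminated : ∀ {j} → Phase j → ∀ k → Z E σ j (K k)
    Phase⇒K-contaminated (untouched z) k = z (K k)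
    Phase⇒K-contaminated (C-cleared _ zK _) = zK
    Phase⇒K-contaminated (C-recontaminated _ zK _) = zK

    next-phase : ∀ j → suc j ≤ len σ → Phase j → Phase (suc j)
    next-phase j j<ℓ (untouched z) with A-shot? j
    ... | inj₁ A⊆shot =
      let zA′ , zK′ = A∪K-stay-contaminated j<ℓ A A-injective A≢K A⊆shot (z ∘ K)
      in C-cleared zA′ zK′ (λ i → suc j , ≤-refl , cleared-now i)
      where
      cleared-now : ∀ i → ClearedAt E σ (suc j) (C i)
      cleared-now i = inj₂ ((A zero , C~A i zero , z (A zero)) , λ _ e _ → C-neighbours-⊆ A⊆shot i e)
    ... | inj₂ (a , a∉) = untouched everything
      where
      everything : ∀ x → Z E σ (suc j) x
      everything x with view x
      ... | vC i = proj₁ (unshot-A-contaminates (z (A a)) a∉) i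
      ... | vK k = proj₂ (unshot-A-contaminates (z (A a)) a∉) k
      ... | vA i with ++-∃∉ (++-injective C-injective K-injective C≢K) (Shot j) (fewer-than-2t-shot j<ℓ)
      ...   | inj₁ (c , c∉) = C c , z (C c) , c∉ , A~C i c
      ...   | inj₂ (k , k∉) = K k , z (K k) , k∉ , A~K i k
    next-phase j j<ℓ (C-cleared zA zK cleared) with A-shot? j
    ... | inj₁ A⊆shot =
      let zA′ , zK′ = A∪K-stay-contaminated j<ℓ A A-injective A≢K A⊆shot zK
      in C-cleared zA′ zK′ (ClearedBefore-suc ∘ cleared)
    ... | inj₂ (a , a∉) =
      let zC′ , zK′ = unshot-A-contaminates (zA a) a∉
      in C-recontaminated zC′ zK′ cleared
    next-phase j j<ℓ (C-recontaminated zC zK cleared) =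
      let zA′ , zK′ = A∪K-stay-contaminated j<ℓ C C-injective C≢K C⊆shot zK
      in C-cleared zA′ zK′ (ClearedBefore-suc ∘ ClearedBefore-suc ∘ cleared)
      where
      C⊆shot : ∀ i → C i ∈ Shot j
      C⊆shot i = recontaminated⇒shot j<ℓ (cleared i) (zC i)

    phase : ∀ j → j ≤ len σ → Phase j
    phase zero _ = untouched (const tt)
    phase (suc j) j<ℓ = next-phase j j<ℓ (phase j (<⇒≤ j<ℓ))

    loses : ¬ Winning E σ
    loses = contaminated⇒¬winning (λ {x} {y} → E-sym {x} {y}) σ
              (Phase⇒K-contaminated (phase (len σ) ≤-refl) zero)

  monotone-hunters-≥ : ∀ p → MonotoneWinsWith E p → t + u ≤ p
  monotone-hunters-≥ p (σ , _ , σ≤p , wins , monotone) =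
    ≮⇒≥ (λ p<t+u → MonotoneLowerBound.loses σ p<t+u σ≤p monotone wins)

3t≤2[t+u]+2 : ∀ u → 3 * suc u ≤ 2 * (suc u + u) + 2
3t≤2[t+u]+2 u = subst (3 * suc u ≤_) (sym (identity u)) (m≤m+n (3 * suc u) (suc u))
  where
  identity : ∀ u → 2 * (suc u + u) + 2 ≡ 3 * suc u + suc u
  identity = solve-∀

lemma4p9 : (k : ℕ) → 2 ≤ k →
    ∃[ n ] Σ (Cotree n) λ G → Connected (Adj G) ×
      ∃[ h ] ∃[ m ] (IsHunterNumber (Adj G) h × IsMonotoneHunterNumber (Adj G) m ×
        k ≤ h × 3 * h ≤ 2 * m + 2)
lemma4p9 zero ()
lemma4p9 (suc u) _ =
  N , G , connected , t , t + u ,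
  (huntStrategy-wins , hunters-≥) , (coverStrategy-wins , monotone-hunters-≥) ,
  ≤-refl , 3t≤2[t+u]+2 u
  where open Witness u
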